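{- Let $G=(V,E)$ be a graph and $B$ a set of terminal pairs. Let $M$ be a node multicut of $(G,B)$, let $\mathrm{comp}(M)\subseteq M$ be any minimal node multicut of $(G,B)$ contained in $M$, and let $M'$ be a minimal node multicut of $(G,B)$. Then $\mathrm{dist}(\mathrm{comp}(M),M')\le \mathrm{dist}(M,M')$.
   Context: Graphs are finite, undirected, connected, simple. $B$ is a set of unordered vertex pairs, $T=T(B)$ the set of vertices in them. A node multicut of $(G,B)$ is $M\subseteq V\setminus T$ such that $G-M$ has no path between $s$ and $t$ for any $\{s,t\}\in B$; minimal means no proper subset is a node multicut. For a node multicut $M$, $\mathcal C_M$ denotes the set of connected components of $G-M$ that contain at least one terminal. Fix a total order on $V$. For a vertex set $C'$ and node multicut $M$, $\mathrm{mcc}(C',M)$ is the connected component $C$ of $G-M$ minimizing $|C'\setminus C|$, ties broken by choosing the component containing the smallest vertex in the fixed order. For node multicuts $M,M'$, $\mathrm{dist}(M,M')=\sum_{C'\in\mathcal C_{M'}}|C'\setminus \mathrm{mcc}(C',M)|$. -}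

module Defs where

open import Data.Nat using (ℕ; zero; suc; _≤ᵇ_; _<ᵇ_)
open import Data.Bool using (Bool; true; false; _∧_; _∨_; not; if_then_else_)
open import Data.Fin using (Fin; toℕ; _≟_)
open import Data.Fin.Subset using (Subset; _∉_; _⊂_; _─_; _∩_; ∣_∣; ⊥)
open import Data.Vec using (lookup; tabulate)
open import Data.List using (List; []; _∷_; map; filterᵇ; foldr; allFin)
open import Data.Nat.ListAction using (sum)
open import Data.List.Relation.Unary.All using (All)
open import Data.Maybe using (Maybe; just; nothing)
open import Data.Product using (_×_; _,_)
open import Relation.Nullary using (¬_)
open import Relation.Nullary.Decidable using (⌊_⌋)
open import Relation.Binary.PropositionalEquality using (_≡_)

anyV : {n : ℕ} → (Fin n → Bool) → Bool
anyV {n} p = foldr (λ w b → p w ∨ b) false (allFin n)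

allV : {n : ℕ} → (Fin n → Bool) → Bool
allV {n} p = foldr (λ w b → p w ∧ b) true (allFin n)

-- A finite, undirected, simple, connected graph on the vertex set Fin n.
-- The fixed total order on V is the natural order of Fin n.
record Graph (n : ℕ) : Set where
  field
    adj   : Fin n → Fin n → Bool
    sym   : ∀ u v → adj u v ≡ adj v u
    irrefl : ∀ u → adj u u ≡ false

  -- walkIn k M u v = true  iff  there is a walk with at most k edges
  -- from u to v in G - M (all vertices of the walk outside M).
  walkIn : ℕ → Subset n → Fin n → Fin n → Bool
  walkIn zero    M u v = not (lookup M u) ∧ ⌊ u ≟ v ⌋
  walkIn (suc k) M u v =
    walkIn k M u v ∨ anyV (λ w → walkIn k M u w ∧ adj w v ∧ not (lookup M v))

  -- u and v are connected in G - M (a path has at most n - 1 ≤ n edges)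
  conn : Subset n → Fin n → Fin n → Bool
  conn M u v = walkIn n M u v

open Graph public

Connected : {n : ℕ} → Graph n → Set
Connected {n} G = ∀ (u v : Fin n) → conn G ⊥ u v ≡ true

-- terminal pairs: a list of (unordered) pairs {s,t}
Pairs : ℕ → Set
Pairs n = List (Fin n × Fin n)

terminals : {n : ℕ} → Pairs n → Subset n
terminals B = tabulate (λ v → foldr (λ st b → (⌊ v ≟ Data.Product.proj₁ st ⌋ ∨ ⌊ v ≟ Data.Product.proj₂ st ⌋) ∨ b) false B)

NodeMulticut : {n : ℕ} → Graph n → Pairs n → Subset n → Set
NodeMulticut G B M =
  All (λ st → Data.Product.proj₁ st ∉ M × Data.Product.proj₂ st ∉ M
              × conn G M (Data.Product.proj₁ st) (Data.Product.proj₂ st) ≡ false) B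

MinimalNodeMulticut : {n : ℕ} → Graph n → Pairs n → Subset n → Set
MinimalNodeMulticut G B M =
  NodeMulticut G B M × (∀ N → N ⊂ M → ¬ NodeMulticut G B N)

-- connected component of v in G - M (empty if v ∈ M)
compOf : {n : ℕ} → Graph n → Subset n → Fin n → Subset n
compOf G M v = tabulate (λ w → conn G M v w)

isRep : {n : ℕ} → Graph n → Subset n → Fin n → Bool
isRep G M v = not (lookup M v) ∧ allV (λ w → not ((toℕ w <ᵇ toℕ v) ∧ conn G M v w))

-- all connected components of G - M, listed in increasing order of
-- their smallest vertex (each exactly once)
components : {n : ℕ} → Graph n → Subset n → List (Subset n)
components {n} G M = map (compOf G M) (filterᵇ (isRep G M) (allFin n))

termComponents : {n : ℕ} → Graph n → Pairs n → Subset n → List (Subset n)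
termComponents {n} G B M =
  filterᵇ (λ C → anyV (λ v → lookup C v ∧ lookup (terminals B) v)) (components G M)

-- mcc(C', M): the component C of G - M minimising |C' \ C|; ties broken in
-- favour of the component containing the smallest vertex.  Since
-- 'components' lists components by increasing smallest vertex, a left-to-right
-- scan that only replaces on strict improvement implements the tie-break.
-- (If G - M has no component at all, the empty set is returned; this case
-- never arises when mcc is used in dist.)
mccAux : {n : ℕ} → Subset n → Maybe (Subset n) → List (Subset n) → Subset n
mccAux C' nothing  []       = ⊥
mccAux C' (just D) []       = D
mccAux C' nothing  (C ∷ Cs) = mccAux C' (just C) Cs
mccAux C' (just D) (C ∷ Cs) =
  mccAux C' (just (if ∣ C' ─ C ∣ <ᵇ ∣ C' ─ D ∣ then C else D)) Cs

mcc : {n : ℕ} → Graph n → Subset n → Subset n → Subset n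
mcc G C' M = mccAux C' nothing (components G M)

dist : {n : ℕ} → Graph n → Pairs n → Subset n → Subset n → ℕ
dist G B M M' = sum (map (λ C' → ∣ C' ─ mcc G C' M ∣) (termComponents G B M'))

module Submission where

-- Let K = comp(M) ⊆ M.  Both sides of the inequality sum over the same list
-- 𝒞_{M'}, so it suffices to compare summands: for every vertex set C',
--     |C' ∖ mcc(C', K)| ≤ |C' ∖ mcc(C', M)|.
-- Since K ⊆ M, every walk in G − M is a walk in G − K, so every component of
-- G − M lies inside a component of G − K.  mcc(C', M) is either the empty set (if
-- G − M has no component) or a component C of G − M.  In the second case C ⊆ D
-- for a listed component D of G − K, the scan computing mcc(C', K) returns
-- something at least as good as D, and |C' ∖ D| ≤ |C' ∖ C|.  In the first case
-- the right-hand side is |C'|, which bounds every |C' ∖ X|.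

open import Defs
open import Data.Nat using (ℕ; _≤_)
open import Data.Fin.Subset using (Subset; _⊆_)

open import Data.Nat using (zero; suc; _+_; _∸_; _<_; _<ᵇ_; _≤′_; ≤′-refl; ≤′-step; z≤n; s≤s)
open import Data.Nat.Properties as ℕ using (≤-refl; ≤-trans)
open import Data.Nat.ListAction using (sum)
open import Data.Bool using (Bool; true; false; _∧_; _∨_; not; if_then_else_)
open import Data.Bool.Properties using (T-≡; ¬-not; not-¬) renaming (_≟_ to _≟ᵇ_)
open import Data.Fin as F using (Fin; toℕ; _≟_)
open import Data.Fin.Properties using (any?)
open import Data.Fin.Induction using (<-wellFounded)
open import Data.Fin.Subset using (_∈_; ∣_∣; _─_)
open import Data.Fin.Subset.Properties
  using (∣p∣≤n; p⊂q⇒∣p∣<∣q∣; x∈p⇒∣p-x∣<∣p∣; drop-∷-⊆; ⊥⊆)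
open import Data.Vec using ([]; _∷_; lookup; tabulate)
import Data.Vec
open import Data.Vec.Properties using (lookup∘tabulate; []=⇒lookup; lookup⇒[]=)
open import Data.List using (List; []; _∷_; map; foldr; allFin)
import Data.List.Membership.Propositional as List
open import Data.List.Relation.Unary.Any using (here; there)
open import Data.List.Membership.Propositional.Properties
  using (∈-allFin; ∈-map⁻; ∈-map⁺; ∈-filter⁺; ∈-filter⁻)
open import Data.Maybe using (just; nothing)
open import Data.Product using (_×_; _,_; ∃; proj₁; proj₂)
open import Data.Sum using (_⊎_; inj₁; inj₂)
open import Data.Empty using (⊥-elim)
open import Function using (_∘_; id)
open import Function.Bundles using (Equivalence)
open import Induction.WellFounded using (Acc; acc)
open import Relation.Nullary using (yes; no)
open import Relation.Nullary.Decidable using (⌊_⌋; T?; _×-dec_)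
open import Relation.Nullary.Reflects using (ofʸ; ofⁿ)
open import Relation.Binary.PropositionalEquality
  using (_≡_; refl; trans; subst) renaming (sym to ≡-sym)

∨-true⁻ : ∀ {a b} → a ∨ b ≡ true → a ≡ true ⊎ b ≡ true
∨-true⁻ {true}  _ = inj₁ refl
∨-true⁻ {false} e = inj₂ e

∨-trueˡ : ∀ {a} b → a ≡ true → a ∨ b ≡ true
∨-trueˡ b refl = refl

∨-trueʳ : ∀ a {b} → b ≡ true → a ∨ b ≡ true
∨-trueʳ true  _ = refl
∨-trueʳ false e = e

∧-true⁻ : ∀ {a b} → a ∧ b ≡ true → a ≡ true × b ≡ true
∧-true⁻ {true} {true} _ = refl , refl

∧-true⁺ : ∀ {a b} → a ≡ true → b ≡ true → a ∧ b ≡ true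
∧-true⁺ refl refl = refl

not-true⁻ : ∀ {a} → not a ≡ true → a ≡ false
not-true⁻ {false} _ = refl

not-false⁻ : ∀ {a} → not a ≡ false → a ≡ true
not-false⁻ {true} _ = refl

not-false⁺ : ∀ {a} → a ≡ false → not a ≡ true
not-false⁺ refl = refl

≟-sound : ∀ {n} {u v : Fin n} → ⌊ u ≟ v ⌋ ≡ true → u ≡ v
≟-sound {u = u} {v} e with u ≟ v
... | yes u≡v = u≡v

≟-refl : ∀ {n} (u : Fin n) → ⌊ u ≟ u ⌋ ≡ true
≟-refl u with u ≟ u
... | yes _  = refl
... | no u≢u = ⊥-elim (u≢u refl)

anyL-true⁺ : {A : Set} (p : A → Bool) {xs : List A} {w : A} →
             w List.∈ xs → p w ≡ true → foldr (λ x b → p x ∨ b) false xs ≡ true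
anyL-true⁺ p {x ∷ xs} (here refl) e = ∨-trueˡ _ e
anyL-true⁺ p {x ∷ xs} (there w∈xs) e = ∨-trueʳ (p x) (anyL-true⁺ p w∈xs e)

anyL-true⁻ : {A : Set} (p : A → Bool) (xs : List A) →
             foldr (λ x b → p x ∨ b) false xs ≡ true → ∃ λ w → p w ≡ true
anyL-true⁻ p (x ∷ xs) e with ∨-true⁻ {p x} e
... | inj₁ px = x , px
... | inj₂ rest = anyL-true⁻ p xs rest

allL-false⁻ : {A : Set} (p : A → Bool) (xs : List A) →
              foldr (λ x b → p x ∧ b) true xs ≡ false → ∃ λ w → p w ≡ false
allL-false⁻ p (x ∷ xs) e with p x in px
... | false = x , px
... | true  = allL-false⁻ p xs e

anyV-true⁺ : ∀ {n} (p : Fin n → Bool) w → p w ≡ true → anyV p ≡ true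
anyV-true⁺ p w = anyL-true⁺ p (∈-allFin w)

anyV-true⁻ : ∀ {n} (p : Fin n → Bool) → anyV p ≡ true → ∃ λ w → p w ≡ true
anyV-true⁻ {n} p = anyL-true⁻ p (allFin n)

∈-tabulate⁺ : ∀ {n} {f : Fin n → Bool} {x} → f x ≡ true → x ∈ tabulate f
∈-tabulate⁺ {f = f} {x} e = lookup⇒[]= x (tabulate f) (trans (lookup∘tabulate f x) e)

∈-tabulate⁻ : ∀ {n} {f : Fin n → Bool} {x} → x ∈ tabulate f → f x ≡ true
∈-tabulate⁻ {f = f} {x} x∈ = trans (≡-sym (lookup∘tabulate f x)) ([]=⇒lookup x∈)

-- Removing a larger set leaves fewer elements: |C ∖ Y| ≤ |C ∖ X| for X ⊆ Y.
-- ('_─_' only computes once the head of its second argument is known, hence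
-- the case split on the heads of X and Y.)

─-antitone : ∀ {n} (C : Subset n) {X Y : Subset n} → X ⊆ Y → ∣ C ─ Y ∣ ≤ ∣ C ─ X ∣
─-antitone [] {[]} {[]} _ = z≤n
─-antitone (c ∷ C) {true ∷ X} {true ∷ Y} X⊆Y = ─-antitone C (drop-∷-⊆ X⊆Y)
─-antitone (false ∷ C) {false ∷ X} {true ∷ Y} X⊆Y = ─-antitone C (drop-∷-⊆ X⊆Y)
─-antitone (true ∷ C) {false ∷ X} {true ∷ Y} X⊆Y = ℕ.m≤n⇒m≤1+n (─-antitone C (drop-∷-⊆ X⊆Y))
─-antitone (c ∷ C) {true ∷ X} {false ∷ Y} X⊆Y with X⊆Y Data.Vec.here
... | ()
─-antitone (false ∷ C) {false ∷ X} {false ∷ Y} X⊆Y = ─-antitone C (drop-∷-⊆ X⊆Y)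
─-antitone (true ∷ C) {false ∷ X} {false ∷ Y} X⊆Y = s≤s (─-antitone C (drop-∷-⊆ X⊆Y))

survives-⊆ : ∀ {n} {K M : Subset n} → K ⊆ M → ∀ x → lookup M x ≡ false → lookup K x ≡ false
survives-⊆ {K = K} K⊆M x x∉M =
  ¬-not λ x∈K → not-¬ x∉M ([]=⇒lookup (K⊆M (lookup⇒[]= x K x∈K)))

module Walks {n : ℕ} (G : Graph n) (M : Subset n) where

  W : ℕ → Fin n → Fin n → Set
  W k u v = walkIn G k M u v ≡ true

  extend : ∀ k {u w v} → W k u w → adj G w v ≡ true → lookup M v ≡ false → W (suc k) u v
  extend k {u} {w} {v} uw wv v∉M = ∨-trueʳ (walkIn G k M u v)
    (anyV-true⁺ (λ x → walkIn G k M u x ∧ adj G x v ∧ not (lookup M v)) w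
      (∧-true⁺ uw (∧-true⁺ wv (not-false⁺ v∉M))))

  unfold : ∀ k {u v} → W (suc k) u v →
           W k u v ⊎ ∃ λ w → W k u w × adj G w v ≡ true × lookup M v ≡ false
  unfold k {u} {v} e with ∨-true⁻ {walkIn G k M u v} e
  ... | inj₁ short = inj₁ short
  ... | inj₂ step with anyV-true⁻ _ step
  ...   | w , uwv with ∧-true⁻ {walkIn G k M u w} uwv
  ...     | uw , wv with ∧-true⁻ {adj G w v} wv
  ...       | wv′ , v∉M = inj₂ (w , uw , wv′ , not-true⁻ v∉M)

  start-survives : ∀ k {u v} → W k u v → lookup M u ≡ false
  start-survives zero {u} e = not-true⁻ (proj₁ (∧-true⁻ {not (lookup M u)} e))
  start-survives (suc k) e with unfold k e
  ... | inj₁ short = start-survives k short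
  ... | inj₂ (_ , uw , _) = start-survives k uw

  end-survives : ∀ k {u v} → W k u v → lookup M v ≡ false
  end-survives zero {u} e with ∧-true⁻ {not (lookup M u)} e
  ... | u∉M , u≡v rewrite ≟-sound u≡v = not-true⁻ u∉M
  end-survives (suc k) e with unfold k e
  ... | inj₁ short = end-survives k short
  ... | inj₂ (_ , _ , _ , v∉M) = v∉M

  empty-walk : ∀ k {u} → lookup M u ≡ false → W k u u
  empty-walk zero {u} u∉M rewrite u∉M = ≟-refl u
  empty-walk (suc k) u∉M = ∨-trueˡ _ (empty-walk k u∉M)

  weaken : ∀ {k j} → k ≤ j → ∀ {u v} → W k u v → W j u v
  weaken k≤j = go (ℕ.≤⇒≤′ k≤j)
    where
    go : ∀ {k j} → k ≤′ j → ∀ {u v} → W k u v → W j u v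
    go ≤′-refl        e = e
    go (≤′-step k≤′j) e = ∨-trueˡ _ (go k≤′j e)

  append : ∀ a b {u w v} → W a u w → W b w v → W (b + a) u v
  append a zero {u} {w} uw wv =
    subst (W a u) (≟-sound (proj₂ (∧-true⁻ {not (lookup M w)} wv))) uw
  append a (suc b) uw wv with unfold b wv
  ... | inj₁ short = ∨-trueˡ _ (append a b uw short)
  ... | inj₂ (_ , wx , xv , v∉M) = extend (b + a) (append a b uw wx) xv v∉M

  reverse : ∀ k {u v} → W k u v → W k v u
  reverse zero {u} e with ∧-true⁻ {not (lookup M u)} e
  ... | _ , u≡v rewrite ≟-sound u≡v = e
  reverse (suc k) {u} {v} e with unfold k e
  ... | inj₁ short = ∨-trueˡ _ (reverse k short)
  ... | inj₂ (w , uw , wv , v∉M) =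
    subst (λ m → W m v u) (ℕ.+-comm k 1)
      (append 1 k (extend 0 (empty-walk 0 v∉M) (trans (Graph.sym G v w) wv)
                            (end-survives k uw))
                  (reverse k uw))

  -- The sets of vertices reachable from u by walks of ≤ k edges grow until
  -- they stop growing once, after which they are constant.  As they live in
  -- Fin n and start nonempty, they stop growing at some k ≤ n.
  module Reach (u : Fin n) where

    reach : ℕ → Subset n
    reach k = tabulate (walkIn G k M u)

    Stable : ℕ → Set
    Stable k = ∀ {v} → W (suc k) u v → W k u v

    stable-forever : ∀ {k} → Stable k → ∀ d {v} → W (d + k) u v → W k u v
    stable-forever st zero e = e
    stable-forever {k} st (suc d) e with unfold (d + k) e
    ... | inj₁ short = stable-forever st d short
    ... | inj₂ (_ , uw , wv , v∉M) = st (extend k (stable-forever st d uw) wv v∉M)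

    stable-or-grows : ∀ k → Stable k ⊎ ∣ reach k ∣ < ∣ reach (suc k) ∣
    stable-or-grows k
      with any? (λ v → (walkIn G (suc k) M u v ≟ᵇ true) ×-dec (walkIn G k M u v ≟ᵇ false))
    ... | yes (v , new , old) =
      inj₂ (p⊂q⇒∣p∣<∣q∣ ( (λ x∈ → ∈-tabulate⁺ (∨-trueˡ _ (∈-tabulate⁻ x∈)))
                         , v , ∈-tabulate⁺ new
                         , λ v∈ → not-¬ old (∈-tabulate⁻ v∈)))
    ... | no nothing-new = inj₁ stable
      where
      stable : Stable k
      stable {v} e with walkIn G k M u v ≟ᵇ true
      ... | yes reached     = reached
      ... | no  not-reached = ⊥-elim (nothing-new (v , e , ¬-not not-reached))

    stabilises-by : lookup M u ≡ false → ∀ k → (∃ λ j → j ≤ k × Stable j) ⊎ k < ∣ reach k ∣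
    stabilises-by u∉M zero =
      inj₂ (ℕ.<-≤-trans (s≤s z≤n) (x∈p⇒∣p-x∣<∣p∣ {p = reach 0} (∈-tabulate⁺ (empty-walk 0 u∉M))))
    stabilises-by u∉M (suc k) with stabilises-by u∉M k
    ... | inj₁ (j , j≤k , st) = inj₁ (j , ℕ.m≤n⇒m≤1+n j≤k , st)
    ... | inj₂ k<∣reach∣ with stable-or-grows k
    ...   | inj₁ st   = inj₁ (k , ℕ.n≤1+n k , st)
    ...   | inj₂ grow = inj₂ (ℕ.<-≤-trans (s≤s k<∣reach∣) grow)

    -- At k = n the second alternative contradicts |reach n| ≤ n.
    stable-within-n : lookup M u ≡ false → ∃ λ j → j ≤ n × Stable j
    stable-within-n u∉M with stabilises-by u∉M n
    ... | inj₁ found = found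
    ... | inj₂ n<∣reach∣ = ⊥-elim (ℕ.<-irrefl refl (ℕ.<-≤-trans n<∣reach∣ (∣p∣≤n (reach n))))

  shorten : ∀ k {u v} → W k u v → W n u v
  shorten k {u} {v} e with Reach.stable-within-n u (start-survives k e)
  ... | j , j≤n , st with k ℕ.≤? n
  ...   | yes k≤n = weaken k≤n e
  ...   | no  k≰n = weaken j≤n (Reach.stable-forever u st (k ∸ j)
                      (subst (λ m → W m u v) (≡-sym (ℕ.m∸n+n≡m j≤k)) e))
    where
    j≤k : j ≤ k
    j≤k = ≤-trans j≤n (ℕ.<⇒≤ (ℕ.≰⇒> k≰n))

  conn-trans : ∀ {u w v} → conn G M u w ≡ true → conn G M w v ≡ true → conn G M u v ≡ true
  conn-trans uw wv = shorten (n + n) (append n n uw wv)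

  conn-sym : ∀ {u v} → conn G M u v ≡ true → conn G M v u ≡ true
  conn-sym = reverse n

  same-component : ∀ {v w} → conn G M v w ≡ true → compOf G M v ⊆ compOf G M w
  same-component vw x∈ = ∈-tabulate⁺ (conn-trans (conn-sym vw) (∈-tabulate⁻ x∈))

walk-⊆ : ∀ {n} (G : Graph n) {K M : Subset n} → K ⊆ M →
         ∀ k {u v} → walkIn G k M u v ≡ true → walkIn G k K u v ≡ true
walk-⊆ G {K} {M} K⊆M zero {u} e with ∧-true⁻ {not (lookup M u)} e
... | u∉M , u≡v = ∧-true⁺ (not-false⁺ (survives-⊆ K⊆M u (not-true⁻ u∉M))) u≡v
walk-⊆ G {K} {M} K⊆M (suc k) e with Walks.unfold G M k e
... | inj₁ short = ∨-trueˡ _ (walk-⊆ G K⊆M k short)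
... | inj₂ (_ , uw , wv , v∉M) =
  Walks.extend G K k (walk-⊆ G K⊆M k uw) wv (survives-⊆ K⊆M _ v∉M)

rep-listed : ∀ {n} (G : Graph n) K {v} → isRep G K v ≡ true → compOf G K v List.∈ components G K
rep-listed G K rep =
  ∈-map⁺ (compOf G K) (∈-filter⁺ (T? ∘ isRep G K) (∈-allFin _) (Equivalence.from T-≡ rep))

rep-survives : ∀ {n} (G : Graph n) K {v} → isRep G K v ≡ true → lookup K v ≡ false
rep-survives G K {v} rep = not-true⁻ (proj₁ (∧-true⁻ {not (lookup K v)} rep))

noSmallerAt : ∀ {n} → Graph n → Subset n → Fin n → Fin n → Bool
noSmallerAt G K v w = not ((toℕ w <ᵇ toℕ v) ∧ conn G K v w)

smaller-in-component : ∀ {n} (G : Graph n) K {v} → lookup K v ≡ false → isRep G K v ≡ false →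
                       ∃ λ w → w F.< v × conn G K v w ≡ true
smaller-in-component {n} G K {v} v∉K notRep
  with allL-false⁻ (noSmallerAt G K v) (allFin n)
         (subst (λ b → not b ∧ allV (noSmallerAt G K v) ≡ false) v∉K notRep)
... | w , e with ∧-true⁻ {toℕ w <ᵇ toℕ v} (not-false⁻ e)
...   | w<ᵇv , vw = w , ℕ.<ᵇ⇒< (toℕ w) (toℕ v) (Equivalence.from T-≡ w<ᵇv) , vw

-- Every surviving vertex's component lies inside a listed component: follow
-- smaller vertices of the component down to its representative.
component-listed : ∀ {n} (G : Graph n) K v → lookup K v ≡ false →
                   ∃ λ D → D List.∈ components G K × compOf G K v ⊆ D
component-listed {n} G K v = go v (<-wellFounded v)
  where
  go : ∀ v → Acc F._<_ v → lookup K v ≡ false →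
       ∃ λ D → D List.∈ components G K × compOf G K v ⊆ D
  go v (acc smaller) v∉K with isRep G K v in rep
  ... | true  = compOf G K v , rep-listed G K rep , id
  ... | false with smaller-in-component G K v∉K rep
  ...   | w , w<v , vw with go w (smaller w<v) (Walks.end-survives G K n vw)
  ...     | D , D∈ , w⊆D = D , D∈ , w⊆D ∘ Walks.same-component G K vw

components-refine : ∀ {n} (G : Graph n) {K M : Subset n} → K ⊆ M →
                    ∀ {C} → C List.∈ components G M →
                    ∃ λ D → D List.∈ components G K × C ⊆ D
components-refine {n} G {K} {M} K⊆M C∈ with ∈-map⁻ (compOf G M) C∈
... | v , v∈reps , refl with ∈-filter⁻ (T? ∘ isRep G M) {xs = allFin n} v∈reps
...   | _ , rep with component-listed G K v
                      (survives-⊆ K⊆M v (rep-survives G M (Equivalence.to T-≡ rep)))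
...     | D , D∈ , vK⊆D =
  D , D∈ , λ x∈ → vK⊆D (∈-tabulate⁺ (walk-⊆ G K⊆M n (∈-tabulate⁻ x∈)))

module Scan {n : ℕ} (C' : Subset n) where

  cost : Subset n → ℕ
  cost X = ∣ C' ─ X ∣

  better : Subset n → Subset n → Subset n
  better C X = if cost C <ᵇ cost X then C else X

  better-≤ : ∀ C X → cost (better C X) ≤ cost X × cost (better C X) ≤ cost C
  better-≤ C X with cost C <ᵇ cost X | ℕ.<ᵇ-reflects-< (cost C) (cost X)
  ... | true  | ofʸ C<X  = ℕ.<⇒≤ C<X , ≤-refl
  ... | false | ofⁿ C≮X  = ≤-refl , ℕ.≮⇒≥ C≮X

  scan-≤-current : ∀ X Cs → cost (mccAux C' (just X) Cs) ≤ cost X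
  scan-≤-current X [] = ≤-refl
  scan-≤-current X (C ∷ Cs) = ≤-trans (scan-≤-current (better C X) Cs) (proj₁ (better-≤ C X))

  scan-optimal : ∀ m Cs {D} → D List.∈ Cs → cost (mccAux C' m Cs) ≤ cost D
  scan-optimal nothing  (C ∷ Cs) (here refl) = scan-≤-current C Cs
  scan-optimal (just X) (C ∷ Cs) (here refl) =
    ≤-trans (scan-≤-current (better C X) Cs) (proj₂ (better-≤ C X))
  scan-optimal nothing  (C ∷ Cs) (there D∈) = scan-optimal (just C) Cs D∈
  scan-optimal (just X) (C ∷ Cs) (there D∈) = scan-optimal (just (better C X)) Cs D∈

  scan-from : ∀ X Cs → mccAux C' (just X) Cs ≡ X ⊎ mccAux C' (just X) Cs List.∈ Cs
  scan-from X [] = inj₁ refl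
  scan-from X (C ∷ Cs) with cost C <ᵇ cost X
  ... | true with scan-from C Cs
  ...   | inj₁ ≡C = inj₂ (subst (List._∈ (C ∷ Cs)) (≡-sym ≡C) (here refl))
  ...   | inj₂ ∈Cs = inj₂ (there ∈Cs)
  scan-from X (C ∷ Cs) | false with scan-from X Cs
  ...   | inj₁ ≡X = inj₁ ≡X
  ...   | inj₂ ∈Cs = inj₂ (there ∈Cs)

  scan-result : ∀ Cs → mccAux C' nothing Cs ≡ Data.Fin.Subset.⊥ ⊎ mccAux C' nothing Cs List.∈ Cs
  scan-result [] = inj₁ refl
  scan-result (C ∷ Cs) with scan-from C Cs
  ... | inj₁ ≡C = inj₂ (subst (List._∈ (C ∷ Cs)) (≡-sym ≡C) (here refl))
  ... | inj₂ ∈Cs = inj₂ (there ∈Cs)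

  scan-refine : ∀ Cs Ds → (∀ {C} → C List.∈ Cs → ∃ λ D → D List.∈ Ds × C ⊆ D) →
                cost (mccAux C' nothing Ds) ≤ cost (mccAux C' nothing Cs)
  scan-refine Cs Ds cover with scan-result Cs
  ... | inj₁ ≡⊥ rewrite ≡⊥ = ─-antitone C' ⊥⊆
  ... | inj₂ C∈ with cover C∈
  ...   | D , D∈ , C⊆D = ≤-trans (scan-optimal nothing Ds D∈) (─-antitone C' C⊆D)

mcc-cost-mono : ∀ {n} (G : Graph n) {K M : Subset n} → K ⊆ M → (C' : Subset n) →
                ∣ C' ─ mcc G C' K ∣ ≤ ∣ C' ─ mcc G C' M ∣
mcc-cost-mono G {K} {M} K⊆M C' =
  Scan.scan-refine C' (components G M) (components G K) (components-refine G K⊆M)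

sum-map-mono : {A : Set} (f g : A → ℕ) → (∀ x → f x ≤ g x) →
               (xs : List A) → sum (map f xs) ≤ sum (map g xs)
sum-map-mono f g f≤g [] = z≤n
sum-map-mono f g f≤g (x ∷ xs) = ℕ.+-mono-≤ (f≤g x) (sum-map-mono f g f≤g xs)

lemma3 : {n : ℕ} (G : Graph n) → Connected G → (B : Pairs n)
    → (M : Subset n) → NodeMulticut G B M
    → (compM : Subset n) → MinimalNodeMulticut G B compM → compM ⊆ M
    → (M' : Subset n) → MinimalNodeMulticut G B M'
    → dist G B compM M' ≤ dist G B M M'
lemma3 G _ B M _ compM _ compM⊆M M' _ =
  sum-map-mono (λ C' → ∣ C' ─ mcc G C' compM ∣) (λ C' → ∣ C' ─ mcc G C' M ∣)
    (mcc-cost-mono G compM⊆M) (termComponents G B M')
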